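{- Let $n\ge1$ and let $0\leq\ell_1<\ell_2<\cdots<\ell_n$ be integers. Let $\mathscr{A}$ be the $n\times n$ matrix with $(i,j)$ entry $(4^{\ell_i})^{j-1}$. Then for every permutation $\tau$ of $\{1,\dots,n\}$, $$\prod_{i=1}^n4^{\ell_i(\tau(i)-1)}\leq\left(\frac43\right)^{n(n-1)/2}\det\mathscr{A}.$$ -}

module Defs where

open import Data.Nat as ℕ using (ℕ; zero; suc)
open import Data.Fin using (Fin; zero; suc; punchIn)
open import Data.Integer as ℤ using (ℤ)

sumFin : ∀ n → (Fin n → ℤ) → ℤ
sumFin zero    f = ℤ.0ℤ
sumFin (suc n) f = f zero ℤ.+ sumFin n (λ i → f (suc i))

prodFin : ∀ n → (Fin n → ℕ) → ℕ
prodFin zero    f = 1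
prodFin (suc n) f = f zero ℕ.* prodFin n (λ i → f (suc i))

sign : ℕ → ℤ
sign zero    = ℤ.1ℤ
sign (suc k) = ℤ.- sign k

det : ∀ n → (Fin n → Fin n → ℤ) → ℤ
det zero    A = ℤ.1ℤ
det (suc n) A =
  sumFin (suc n) (λ j → sign (Data.Fin.toℕ j) ℤ.* A zero j ℤ.*
                         det n (λ r c → A (suc r) (punchIn j c)))

{-# OPTIONS --safe #-}
-- The determinant is the Vandermonde product ∏_{i<j} (4^ℓⱼ − 4^ℓᵢ), obtained from the first-row
-- Laplace expansion by column operations. As 4^ℓᵢ ≤ 4^ℓⱼ / 4 for i < j, each factor is at least
-- (3/4) 4^ℓⱼ, so the determinant is at least (3/4)^(n(n−1)/2) ∏ⱼ 4^(ℓⱼ (j−1)); by the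
-- rearrangement inequality for the increasing sequence 4^ℓᵢ this product dominates
-- ∏ᵢ 4^(ℓᵢ (τ(i)−1)).
module Submission where

open import Defs
open import Data.Nat.Base as ℕ using (ℕ; zero; suc)
import Data.Nat.Properties as ℕ
open import Data.Fin as Fin using (Fin; zero; suc; toℕ; punchIn; punchOut)
import Data.Fin.Properties as Fin
open import Data.Empty using (⊥-elim)
open import Data.Product using (_×_; _,_)
open import Data.Sum using (_⊎_; inj₁; inj₂)
open import Function using (_∘_)
open import Relation.Binary.PropositionalEquality
open import Relation.Nullary using (yes; no)

module _ where
  open import Data.Integer.Base using (ℤ; 0ℤ; 1ℤ; _+_; _-_; -_; _*_; _^_)
  import Data.Integer.Properties as ℤ
  open import Data.Integer.Tactic.RingSolver using (solve-∀)
  open import Algebra.Properties.CommutativeSemigroup ℤ.+-commutativeSemigroup using (interchange)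
  open import Data.Vec.Functional using (updateAt)
  open import Data.Vec.Functional.Properties using (updateAt-updates; updateAt-minimal)
  open ≡-Reasoning

  sumFin-cong : ∀ n {f g : Fin n → ℤ} → (∀ i → f i ≡ g i) → sumFin n f ≡ sumFin n g
  sumFin-cong zero    f≗g = refl
  sumFin-cong (suc n) f≗g = cong₂ _+_ (f≗g zero) (sumFin-cong n (f≗g ∘ suc))

  sumFin-+ : ∀ n (f g : Fin n → ℤ) → sumFin n (λ i → f i + g i) ≡ sumFin n f + sumFin n g
  sumFin-+ zero    f g = refl
  sumFin-+ (suc n) f g = trans (cong (f zero + g zero +_) (sumFin-+ n (f ∘ suc) (g ∘ suc)))
                               (interchange (f zero) (g zero) _ _)

  sumFin-*ˡ : ∀ n t (f : Fin n → ℤ) → sumFin n (λ i → t * f i) ≡ t * sumFin n f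
  sumFin-*ˡ zero    t f = sym (ℤ.*-zeroʳ t)
  sumFin-*ˡ (suc n) t f = trans (cong (t * f zero +_) (sumFin-*ˡ n t (f ∘ suc)))
                                (sym (ℤ.*-distribˡ-+ t (f zero) _))

  sumFin-zero : ∀ n (f : Fin n → ℤ) → (∀ i → f i ≡ 0ℤ) → sumFin n f ≡ 0ℤ
  sumFin-zero zero    f f≗0 = refl
  sumFin-zero (suc n) f f≗0 = cong₂ _+_ (f≗0 zero) (sumFin-zero n (f ∘ suc) (f≗0 ∘ suc))

  sumFin-single : ∀ n (f : Fin n → ℤ) a → (∀ j → j ≢ a → f j ≡ 0ℤ) → sumFin n f ≡ f a
  sumFin-single (suc n) f zero    f≗0 =
    trans (cong (f zero +_) (sumFin-zero n (f ∘ suc) λ j → f≗0 (suc j) λ ()))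
          (ℤ.+-identityʳ (f zero))
  sumFin-single (suc n) f (suc a) f≗0 =
    trans (cong (_+ sumFin n (f ∘ suc)) (f≗0 zero λ ()))
    (trans (ℤ.+-identityˡ _)
          (sumFin-single n (f ∘ suc) a λ j j≢a → f≗0 (suc j) (j≢a ∘ Fin.suc-injective)))

  sumFin-pair : ∀ n (f : Fin n → ℤ) {a b} → a ≢ b → (∀ j → j ≢ a → j ≢ b → f j ≡ 0ℤ) →
                sumFin n f ≡ f a + f b
  sumFin-pair (suc n) f {zero}  {zero}  a≢b f≗0 = ⊥-elim (a≢b refl)
  sumFin-pair (suc n) f {zero}  {suc b} a≢b f≗0 =
    cong (f zero +_) (sumFin-single n (f ∘ suc) b λ j j≢b →
      f≗0 (suc j) (λ ()) (j≢b ∘ Fin.suc-injective))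
  sumFin-pair (suc n) f {suc a} {zero}  a≢b f≗0 =
    trans (cong (f zero +_) (sumFin-single n (f ∘ suc) a λ j j≢a →
             f≗0 (suc j) (j≢a ∘ Fin.suc-injective) (λ ())))
          (ℤ.+-comm (f zero) (f (suc a)))
  sumFin-pair (suc n) f {suc a} {suc b} a≢b f≗0 =
    trans (cong (_+ sumFin n (f ∘ suc)) (f≗0 zero (λ ()) (λ ())))
    (trans (ℤ.+-identityˡ _)
          (sumFin-pair n (f ∘ suc) (a≢b ∘ cong suc) λ j j≢a j≢b →
             f≗0 (suc j) (j≢a ∘ Fin.suc-injective) (j≢b ∘ Fin.suc-injective)))

  Matrix : ℕ → Set
  Matrix n = Fin n → Fin n → ℤ

  minor : ∀ {n} → Matrix (suc n) → Fin (suc n) → Matrix n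
  minor A j r c = A (suc r) (punchIn j c)

  laplaceTerm : ∀ n → Matrix (suc n) → Fin (suc n) → ℤ
  laplaceTerm n A j = sign (toℕ j) * A zero j * det n (minor A j)

  AgreeOutsideColumn : ∀ {n} → Fin n → Matrix n → Matrix n → Set
  AgreeOutsideColumn k A B = ∀ r c → c ≢ k → A r c ≡ B r c

  Adjacent : ∀ {n} → Fin n → Fin n → Set
  Adjacent a b = toℕ b ≡ suc (toℕ a)

  Adjacent⇒≢ : ∀ {n} {a b : Fin n} → Adjacent a b → a ≢ b
  Adjacent⇒≢ b≡1+a a≡b = ℕ.1+n≢n (sym (trans (cong toℕ a≡b) b≡1+a))

  det-cong : ∀ n {A B : Matrix n} → (∀ r c → A r c ≡ B r c) → det n A ≡ det n B
  det-cong zero    A≗B = refl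
  det-cong (suc n) A≗B = sumFin-cong (suc n) λ j →
    cong₂ (λ a d → sign (toℕ j) * a * d) (A≗B zero j) (det-cong n λ r c → A≗B (suc r) (punchIn j c))

  det-minor-cong : ∀ n {A B : Matrix (suc n)} k → AgreeOutsideColumn k A B →
                   det n (minor A k) ≡ det n (minor B k)
  det-minor-cong n k A≈B = det-cong n λ r c → A≈B (suc r) (punchIn k c) (Fin.punchInᵢ≢i k c)

  minor-agreeOutsideColumn : ∀ {n} {A B : Matrix (suc n)} {j k} (j≢k : j ≢ k) →
    AgreeOutsideColumn k A B → AgreeOutsideColumn (punchOut j≢k) (minor A j) (minor B j)
  minor-agreeOutsideColumn {j = j} j≢k A≈B r c c≢k′ = A≈B (suc r) (punchIn j c) λ eq →
    c≢k′ (Fin.punchIn-injective j c _ (trans eq (sym (Fin.punchIn-punchOut j≢k))))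

  det-linear-column : ∀ n {A B C : Matrix n} k t → AgreeOutsideColumn k C A → AgreeOutsideColumn k C B →
                      (∀ r → C r k ≡ A r k + t * B r k) → det n C ≡ det n A + t * det n B
  det-linear-column (suc n) {A} {B} {C} k t C≈A C≈B Cₖ = begin
    sumFin (suc n) (laplaceTerm n C)
      ≡⟨ sumFin-cong (suc n) term ⟩
    sumFin (suc n) (λ j → laplaceTerm n A j + t * laplaceTerm n B j)
      ≡⟨ sumFin-+ (suc n) (laplaceTerm n A) (λ j → t * laplaceTerm n B j) ⟩
    det (suc n) A + sumFin (suc n) (λ j → t * laplaceTerm n B j)
      ≡⟨ cong (det (suc n) A +_) (sumFin-*ˡ (suc n) t (laplaceTerm n B)) ⟩
    det (suc n) A + t * det (suc n) B ∎
    where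
    expandˡ : ∀ s a b t d → s * (a + t * b) * d ≡ s * a * d + t * (s * b * d)
    expandˡ = solve-∀
    expandʳ : ∀ s a x t y → s * a * (x + t * y) ≡ s * a * x + t * (s * a * y)
    expandʳ = solve-∀
    term : ∀ j → laplaceTerm n C j ≡ laplaceTerm n A j + t * laplaceTerm n B j
    term j with j Fin.≟ k
    ... | yes refl
      rewrite Cₖ zero | sym (det-minor-cong n j C≈B) | det-minor-cong n j C≈A
      = expandˡ (sign (toℕ j)) (A zero j) (B zero j) t _
    ... | no j≢k
      rewrite det-linear-column n (punchOut j≢k) t
                (minor-agreeOutsideColumn j≢k C≈A) (minor-agreeOutsideColumn j≢k C≈B)
                (λ r → subst (λ c → C (suc r) c ≡ A (suc r) c + t * B (suc r) c)
                             (sym (Fin.punchIn-punchOut j≢k)) (Cₖ (suc r)))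
            | sym (C≈A zero j j≢k) | sym (C≈B zero j j≢k)
      = expandʳ (sign (toℕ j)) (C zero j) _ t _

  punchOut-adjacent : ∀ {m} (j a b : Fin (suc m)) (j≢a : j ≢ a) (j≢b : j ≢ b) →
                      Adjacent a b → Adjacent (punchOut j≢a) (punchOut j≢b)
  punchOut-adjacent zero zero b j≢a j≢b b≡1+a = ⊥-elim (j≢a refl)
  punchOut-adjacent zero (suc a) (suc b) j≢a j≢b b≡1+a = ℕ.suc-injective b≡1+a
  punchOut-adjacent {suc m} (suc zero) zero (suc zero) j≢a j≢b b≡1+a = ⊥-elim (j≢b refl)
  punchOut-adjacent {suc (suc m)} (suc (suc j)) zero (suc zero) j≢a j≢b b≡1+a = refl
  punchOut-adjacent {suc m} (suc j) (suc a) (suc b) j≢a j≢b b≡1+a =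
    cong suc (punchOut-adjacent j a b (j≢a ∘ cong suc) (j≢b ∘ cong suc) (ℕ.suc-injective b≡1+a))

  punchIn-adjacent : ∀ {m} (a b : Fin (suc m)) (c : Fin m) → Adjacent a b →
                     punchIn a c ≡ punchIn b c ⊎ (punchIn a c ≡ b × punchIn b c ≡ a)
  punchIn-adjacent zero    (suc zero) zero    b≡1+a = inj₂ (refl , refl)
  punchIn-adjacent zero    (suc zero) (suc c) b≡1+a = inj₁ refl
  punchIn-adjacent (suc a) (suc b)    zero    b≡1+a = inj₁ refl
  punchIn-adjacent (suc a) (suc b)    (suc c) b≡1+a with punchIn-adjacent a b c (ℕ.suc-injective b≡1+a)
  ... | inj₁ eq         = inj₁ (cong suc eq)
  ... | inj₂ (eqa , eqb) = inj₂ (cong suc eqa , cong suc eqb)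

  -- The two first-row terms of the equal columns cancel because their minors coincide
  -- while their signs differ; this needs the columns to be adjacent.
  det-equal-adjacent-columns : ∀ n (A : Matrix n) {a b} → Adjacent a b → (∀ r → A r a ≡ A r b) →
                               det n A ≡ 0ℤ
  det-equal-adjacent-columns (suc n) A {a} {b} b≡1+a Aa≡Ab = begin
    sumFin (suc n) (laplaceTerm n A)
      ≡⟨ sumFin-pair (suc n) (laplaceTerm n A) (Adjacent⇒≢ b≡1+a) other-terms ⟩
    laplaceTerm n A a + laplaceTerm n A b
      ≡⟨ pair-cancels ⟩
    0ℤ ∎
    where
    other-terms : ∀ j → j ≢ a → j ≢ b → laplaceTerm n A j ≡ 0ℤ
    other-terms j j≢a j≢b =
      trans (cong (sign (toℕ j) * A zero j *_)
                  (det-equal-adjacent-columns n (minor A j) (punchOut-adjacent j a b j≢a j≢b b≡1+a) λ r →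
                     trans (cong (A (suc r)) (Fin.punchIn-punchOut j≢a))
                           (trans (Aa≡Ab (suc r)) (sym (cong (A (suc r)) (Fin.punchIn-punchOut j≢b))))))
            (ℤ.*-zeroʳ (sign (toℕ j) * A zero j))
    same-minor : ∀ r c → minor A a r c ≡ minor A b r c
    same-minor r c with punchIn-adjacent a b c b≡1+a
    ... | inj₁ eq          = cong (A (suc r)) eq
    ... | inj₂ (eqa , eqb) = trans (cong (A (suc r)) eqa)
                                   (trans (sym (Aa≡Ab (suc r))) (sym (cong (A (suc r)) eqb)))
    cancel : ∀ s x d → s * x * d + - s * x * d ≡ 0ℤ
    cancel = solve-∀
    pair-cancels : laplaceTerm n A a + laplaceTerm n A b ≡ 0ℤ
    pair-cancels rewrite b≡1+a | Aa≡Ab zero | det-cong n same-minor = cancel (sign (toℕ a)) (A zero b) _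

  det-add-adjacent-column : ∀ n {A C : Matrix n} {a b} t → Adjacent a b → AgreeOutsideColumn b C A →
                            (∀ r → C r b ≡ A r b + t * A r a) → det n C ≡ det n A
  det-add-adjacent-column n {A} {C} {a} {b} t b≡1+a C≈A Cᵦ = begin
    det n C                ≡⟨ det-linear-column n b t C≈A C≈B Cᵦ′ ⟩
    det n A + t * det n B  ≡⟨ cong (λ d → det n A + t * d)
                                     (det-equal-adjacent-columns n B b≡1+a Bₐ≡Bᵦ) ⟩
    det n A + t * 0ℤ       ≡⟨ cong (det n A +_) (ℤ.*-zeroʳ t) ⟩
    det n A + 0ℤ           ≡⟨ ℤ.+-identityʳ (det n A) ⟩
    det n A                ∎
    where
    B : Matrix n
    B r = updateAt (A r) b λ _ → A r a
    C≈B : AgreeOutsideColumn b C B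
    C≈B r c c≢b = trans (C≈A r c c≢b) (sym (updateAt-minimal c b (A r) c≢b))
    Cᵦ′ : ∀ r → C r b ≡ A r b + t * B r b
    Cᵦ′ r = trans (Cᵦ r) (cong (λ x → A r b + t * x) (sym (updateAt-updates b (A r))))
    Bₐ≡Bᵦ : ∀ r → B r a ≡ B r b
    Bₐ≡Bᵦ r = trans (updateAt-minimal a b (A r) (Adjacent⇒≢ b≡1+a)) (sym (updateAt-updates b (A r)))

  prodFinℤ : ∀ n → (Fin n → ℤ) → ℤ
  prodFinℤ zero    f = 1ℤ
  prodFinℤ (suc n) f = f zero * prodFinℤ n (f ∘ suc)

  prodFinℤ-cong : ∀ n {f g : Fin n → ℤ} → (∀ i → f i ≡ g i) → prodFinℤ n f ≡ prodFinℤ n g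
  prodFinℤ-cong zero    f≗g = refl
  prodFinℤ-cong (suc n) f≗g = cong₂ _*_ (f≗g zero) (prodFinℤ-cong n (f≗g ∘ suc))

  det-scale-rows : ∀ n (s : Fin n → ℤ) (A : Matrix n) →
                   det n (λ r c → s r * A r c) ≡ prodFinℤ n s * det n A
  det-scale-rows zero    s A = refl
  det-scale-rows (suc n) s A =
    trans (sumFin-cong (suc n) term) (sumFin-*ˡ (suc n) (prodFinℤ (suc n) s) (laplaceTerm n A))
    where
    regroup : ∀ g a m p d → g * (a * m) * (p * d) ≡ a * p * (g * m * d)
    regroup = solve-∀
    term : ∀ j → laplaceTerm n (λ r c → s r * A r c) j ≡ prodFinℤ (suc n) s * laplaceTerm n A j
    term j = trans (cong (sign (toℕ j) * (s zero * A zero j) *_) (det-scale-rows n (s ∘ suc) (minor A j)))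
                   (regroup (sign (toℕ j)) (s zero) (A zero j) _ _)

  subtractPrevious : ℤ → ℕ → (ℕ → ℤ) → ℕ → ℤ
  subtractPrevious t k a c with c ℕ.≤? k
  ... | yes _ = a c
  ... | no  _ = a c - t * a (ℕ.pred c)

  subtractPrevious-≤ : ∀ t {k} a {c} → c ℕ.≤ k → subtractPrevious t k a c ≡ a c
  subtractPrevious-≤ t {k} a {c} c≤k with c ℕ.≤? k
  ... | yes _   = refl
  ... | no  c≰k = ⊥-elim (c≰k c≤k)

  subtractPrevious-> : ∀ t {k} a {c} → k ℕ.< c → subtractPrevious t k a c ≡ a c - t * a (ℕ.pred c)
  subtractPrevious-> t {k} a {c} k<c with c ℕ.≤? k
  ... | yes c≤k = ⊥-elim (ℕ.<⇒≱ k<c c≤k)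
  ... | no  _   = refl

  subtractPrevious-suc : ∀ t k a {c} → c ≢ suc k → subtractPrevious t k a c ≡ subtractPrevious t (suc k) a c
  subtractPrevious-suc t k a {c} c≢1+k with c ℕ.≤? k
  ... | yes c≤k = sym (subtractPrevious-≤ t a (ℕ.m≤n⇒m≤1+n c≤k))
  ... | no  c≰k = sym (subtractPrevious-> t a (ℕ.≤∧≢⇒< (ℕ.≰⇒> c≰k) (c≢1+k ∘ sym)))

  det-subtractPrevious-step : ∀ n t (a : Fin n → ℕ → ℤ) {k} → suc k ℕ.< n →
    det n (λ r c → subtractPrevious t k (a r) (toℕ c)) ≡
    det n (λ r c → subtractPrevious t (suc k) (a r) (toℕ c))
  det-subtractPrevious-step n t a {k} 1+k<n =
    det-add-adjacent-column n (- t) (trans toℕ-1+k (cong suc (sym toℕ-k))) agree column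
    where
    kᶠ 1+kᶠ : Fin n
    kᶠ   = Fin.fromℕ< (ℕ.<-trans (ℕ.n<1+n k) 1+k<n)
    1+kᶠ = Fin.fromℕ< 1+k<n
    toℕ-k : toℕ kᶠ ≡ k
    toℕ-k = Fin.toℕ-fromℕ< _
    toℕ-1+k : toℕ 1+kᶠ ≡ suc k
    toℕ-1+k = Fin.toℕ-fromℕ< 1+k<n
    agree : AgreeOutsideColumn 1+kᶠ (λ r c → subtractPrevious t k (a r) (toℕ c))
                                    (λ r c → subtractPrevious t (suc k) (a r) (toℕ c))
    agree r c c≢1+k = subtractPrevious-suc t k (a r) λ eq →
      c≢1+k (Fin.toℕ-injective (trans eq (sym toℕ-1+k)))
    column : ∀ r → subtractPrevious t k (a r) (toℕ 1+kᶠ) ≡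
                   subtractPrevious t (suc k) (a r) (toℕ 1+kᶠ) + - t * subtractPrevious t (suc k) (a r) (toℕ kᶠ)
    column r = begin
      subtractPrevious t k (a r) (toℕ 1+kᶠ)  ≡⟨ cong (subtractPrevious t k (a r)) toℕ-1+k ⟩
      subtractPrevious t k (a r) (suc k)     ≡⟨ subtractPrevious-> t (a r) (ℕ.n<1+n k) ⟩
      a r (suc k) - t * a r k                ≡⟨ cong (a r (suc k) +_) (ℤ.neg-distribˡ-* t (a r k)) ⟩
      a r (suc k) + - t * a r k              ≡⟨ sym (cong₂ (λ x y → x + - t * y) unchanged-1+k unchanged-k) ⟩
      subtractPrevious t (suc k) (a r) (toℕ 1+kᶠ) + - t * subtractPrevious t (suc k) (a r) (toℕ kᶠ) ∎
      where
      unchanged-1+k : subtractPrevious t (suc k) (a r) (toℕ 1+kᶠ) ≡ a r (suc k)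
      unchanged-1+k = trans (cong (subtractPrevious t (suc k) (a r)) toℕ-1+k)
                            (subtractPrevious-≤ t (a r) ℕ.≤-refl)
      unchanged-k : subtractPrevious t (suc k) (a r) (toℕ kᶠ) ≡ a r k
      unchanged-k = trans (cong (subtractPrevious t (suc k) (a r)) toℕ-k)
                          (subtractPrevious-≤ t (a r) (ℕ.n≤1+n k))

  det-subtractPrevious : ∀ n t (a : Fin n → ℕ → ℤ) →
    det n (λ r c → subtractPrevious t 0 (a r) (toℕ c)) ≡ det n (λ r c → a r (toℕ c))
  det-subtractPrevious zero    t a = refl
  det-subtractPrevious (suc m) t a = from m 0 (ℕ.+-identityʳ m)
    where
    from : ∀ d k → d ℕ.+ k ≡ m →
           det (suc m) (λ r c → subtractPrevious t k (a r) (toℕ c)) ≡ det (suc m) (λ r c → a r (toℕ c))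
    from zero    k refl = det-cong (suc m) λ r c → subtractPrevious-≤ t (a r) (Fin.toℕ≤pred[n] c)
    from (suc d) k d+1+k≡m =
      trans (det-subtractPrevious-step (suc m) t a
               (ℕ.s≤s (subst (suc k ℕ.≤_) d+1+k≡m (ℕ.s≤s (ℕ.m≤n+m k d)))))
            (from d (suc k) (trans (ℕ.+-suc d k) d+1+k≡m))

  vandermonde : ∀ n → (Fin n → ℤ) → ℤ
  vandermonde zero    y = 1ℤ
  vandermonde (suc n) y = prodFinℤ n (λ r → y (suc r) - y zero) * vandermonde n (y ∘ suc)

  -- Subtracting y₀ times each column from the next clears the first row except for its leading 1.
  det-vandermonde : ∀ n (y : Fin n → ℤ) → det n (λ r c → y r ^ toℕ c) ≡ vandermonde n y
  det-vandermonde zero    y = refl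
  det-vandermonde (suc n) y = begin
    det (suc n) (λ r c → y r ^ toℕ c)   ≡⟨ sym (det-subtractPrevious (suc n) (y zero) λ r c → y r ^ c) ⟩
    sumFin (suc n) (laplaceTerm n S)    ≡⟨ sumFin-single (suc n) (laplaceTerm n S) zero first-row-vanishes ⟩
    1ℤ * det n (minor S zero)           ≡⟨ ℤ.*-identityˡ _ ⟩
    det n (minor S zero)                ≡⟨ det-cong n factor-minor ⟩
    det n (λ r c → (y (suc r) - y zero) * y (suc r) ^ toℕ c)
      ≡⟨ det-scale-rows n (λ r → y (suc r) - y zero) (λ r c → y (suc r) ^ toℕ c) ⟩
    prodFinℤ n (λ r → y (suc r) - y zero) * det n (λ r c → y (suc r) ^ toℕ c)
      ≡⟨ cong (prodFinℤ n (λ r → y (suc r) - y zero) *_) (det-vandermonde n (y ∘ suc)) ⟩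
    vandermonde (suc n) y               ∎
    where
    S : Matrix (suc n)
    S r c = subtractPrevious (y zero) 0 (y r ^_) (toℕ c)
    vanish : ∀ s x p d → s * (x * p - x * p) * d ≡ 0ℤ
    vanish = solve-∀
    factor : ∀ x y₀ p → x * p - y₀ * p ≡ (x - y₀) * p
    factor = solve-∀
    first-row-vanishes : ∀ j → j ≢ zero → laplaceTerm n S j ≡ 0ℤ
    first-row-vanishes zero    0≢0 = ⊥-elim (0≢0 refl)
    first-row-vanishes (suc j) _   = vanish (sign (suc (toℕ j))) (y zero) (y zero ^ toℕ j) _
    factor-minor : ∀ r c → minor S zero r c ≡ (y (suc r) - y zero) * y (suc r) ^ toℕ c
    factor-minor r c = factor (y (suc r)) (y zero) (y (suc r) ^ toℕ c)

open import Data.Nat using (ℕ; _≤_; _^_; _*_; _∸_)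
open import Data.Nat.Base using (_/_; _+_; z≤n; s≤s)
open import Data.Fin using (Fin; toℕ; _<_)
open import Data.Fin.Permutation using (Permutation′; _⟨$⟩ʳ_; _⟨$⟩ˡ_; remove; inverseʳ; punchIn-permute′)
open import Data.Integer using (+_) renaming (_≤_ to _≤ℤ_; _*_ to _*ℤ_)
open import Data.Nat.Properties
open import Data.Nat.DivMod using (m*n/n≡m)
open import Data.Nat.Tactic.RingSolver using (solve-∀)
open import Algebra.Properties.CommutativeSemigroup *-commutativeSemigroup using (interchange; x∙yz≈y∙xz)
open import Relation.Binary.Core using (_Preserves_⟶_)
import Data.Integer as ℤ
import Data.Integer.Properties as ℤ

prodFin-cong : ∀ n {f g : Fin n → ℕ} → (∀ i → f i ≡ g i) → prodFin n f ≡ prodFin n g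
prodFin-cong zero    f≗g = refl
prodFin-cong (suc n) f≗g = cong₂ _*_ (f≗g zero) (prodFin-cong n (f≗g ∘ suc))

prodFin-mono-≤ : ∀ n {f g : Fin n → ℕ} → (∀ i → f i ≤ g i) → prodFin n f ≤ prodFin n g
prodFin-mono-≤ zero    f≤g = ≤-refl
prodFin-mono-≤ (suc n) f≤g = *-mono-≤ (f≤g zero) (prodFin-mono-≤ n (f≤g ∘ suc))

prodFin-* : ∀ n (f g : Fin n → ℕ) → prodFin n (λ i → f i * g i) ≡ prodFin n f * prodFin n g
prodFin-* zero    f g = refl
prodFin-* (suc n) f g = trans (cong (f zero * g zero *_) (prodFin-* n (f ∘ suc) (g ∘ suc)))
                              (interchange (f zero) (g zero) _ _)

prodFin-const : ∀ n c → prodFin n (λ _ → c) ≡ c ^ n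
prodFin-const zero    c = refl
prodFin-const (suc n) c = cong (c *_) (prodFin-const n c)

prodFin-*ˡ : ∀ n c (f : Fin n → ℕ) → prodFin n (λ i → c * f i) ≡ c ^ n * prodFin n f
prodFin-*ˡ n c f = trans (prodFin-* n (λ _ → c) f) (cong (_* prodFin n f) (prodFin-const n c))

prodFin-remove : ∀ n (f : Fin (suc n) → ℕ) i → prodFin (suc n) f ≡ f i * prodFin n (f ∘ punchIn i)
prodFin-remove n       f zero    = refl
prodFin-remove (suc n) f (suc i) =
  trans (cong (f zero *_) (prodFin-remove n (f ∘ suc) i))
        (x∙yz≈y∙xz (f zero) (f (suc i)) _)

punchIn≤suc : ∀ {n} (i : Fin (suc n)) j → toℕ (punchIn i j) ≤ suc (toℕ j)
punchIn≤suc zero    j       = ≤-refl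
punchIn≤suc (suc i) zero    = z≤n
punchIn≤suc (suc i) (suc j) = s≤s (punchIn≤suc i j)

-- Take out i₀ = τ⁻¹ 0: its factor is 1, and every other exponent is one more than under
-- remove i₀ τ; the extra factors x (punchIn i₀ j) are at most x (suc j).
prodFin-^-permute-≤ : ∀ n (x : Fin n → ℕ) → x Preserves Fin._≤_ ⟶ _≤_ → (τ : Permutation′ n) →
                      prodFin n (λ i → x i ^ toℕ (τ ⟨$⟩ʳ i)) ≤ prodFin n (λ i → x i ^ toℕ i)
prodFin-^-permute-≤ zero    x x-mono τ = ≤-refl
prodFin-^-permute-≤ (suc n) x x-mono τ = begin
  prodFin (suc n) (λ i → x i ^ toℕ (τ ⟨$⟩ʳ i))
    ≡⟨ prodFin-remove n (λ i → x i ^ toℕ (τ ⟨$⟩ʳ i)) i₀ ⟩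
  x i₀ ^ toℕ (τ ⟨$⟩ʳ i₀) * prodFin n (λ j → x′ j ^ toℕ (τ ⟨$⟩ʳ punchIn i₀ j))
    ≡⟨ cong₂ _*_ (cong (λ p → x i₀ ^ toℕ p) (inverseʳ τ))
                 (prodFin-cong n λ j → cong (λ p → x′ j ^ toℕ p) (punchIn-permute′ τ zero j)) ⟩
  1 * prodFin n (λ j → x′ j * x′ j ^ toℕ (τ′ ⟨$⟩ʳ j))
    ≡⟨ trans (*-identityˡ _) (prodFin-* n x′ _) ⟩
  prodFin n x′ * prodFin n (λ j → x′ j ^ toℕ (τ′ ⟨$⟩ʳ j))
    ≤⟨ *-monoʳ-≤ (prodFin n x′)
         (prodFin-^-permute-≤ n x′ (λ j≤k → x-mono (Fin.punchIn-mono-≤ i₀ _ _ j≤k)) τ′) ⟩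
  prodFin n x′ * prodFin n (λ j → x′ j ^ toℕ j)
    ≡⟨ sym (prodFin-* n x′ _) ⟩
  prodFin n (λ j → x′ j ^ suc (toℕ j))
    ≤⟨ prodFin-mono-≤ n (λ j → ^-monoˡ-≤ (suc (toℕ j)) (x-mono (punchIn≤suc i₀ j))) ⟩
  prodFin n (λ j → x (suc j) ^ suc (toℕ j))
    ≡⟨ sym (*-identityˡ _) ⟩
  prodFin (suc n) (λ i → x i ^ toℕ i) ∎
  where
  open ≤-Reasoning
  i₀ : Fin (suc n)
  i₀ = τ ⟨$⟩ˡ zero
  τ′ : Permutation′ n
  τ′ = remove i₀ τ
  x′ : Fin n → ℕ
  x′ = x ∘ punchIn i₀

triangle : ℕ → ℕ
triangle zero    = 0
triangle (suc n) = n + triangle n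

triangle-suc-*2 : ∀ n → triangle (suc n) * 2 ≡ suc n * n
triangle-suc-*2 zero    = refl
triangle-suc-*2 (suc n) = begin
  (suc n + triangle (suc n)) * 2      ≡⟨ *-distribʳ-+ 2 (suc n) (triangle (suc n)) ⟩
  suc n * 2 + triangle (suc n) * 2    ≡⟨ cong (_+_ (suc n * 2)) (triangle-suc-*2 n) ⟩
  suc n * 2 + suc n * n               ≡⟨ regroup n ⟩
  suc (suc n) * suc n                 ∎
  where
  open ≡-Reasoning
  regroup : ∀ n → suc n * 2 + suc n * n ≡ suc (suc n) * suc n
  regroup = solve-∀

n*[n∸1]/2≡triangle : ∀ n → n * (n ∸ 1) / 2 ≡ triangle n
n*[n∸1]/2≡triangle zero    = refl
n*[n∸1]/2≡triangle (suc n) = trans (cong (_/ 2) (sym (triangle-suc-*2 n))) (m*n/n≡m (triangle (suc n)) 2)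

FourfoldIncreasing : ∀ {n} → (Fin n → ℕ) → Set
FourfoldIncreasing x = ∀ i j → i < j → 4 * x i ≤ x j

fourfoldIncreasing⇒monotone : ∀ {n} {x : Fin n → ℕ} → FourfoldIncreasing x → x Preserves Fin._≤_ ⟶ _≤_
fourfoldIncreasing⇒monotone {x = x} gaps {i} {j} i≤j with m≤n⇒m<n∨m≡n i≤j
... | inj₁ i<j = ≤-trans (m≤n*m (x i) 4) (gaps i j i<j)
... | inj₂ i≡j = ≤-reflexive (cong x (Fin.toℕ-injective i≡j))

-- Uses truncated subtraction, so it is the Vandermonde product only for monotone x.
vandermondeℕ : ∀ n → (Fin n → ℕ) → ℕ
vandermondeℕ zero    x = 1
vandermondeℕ (suc n) x = prodFin n (λ r → x (suc r) ∸ x zero) * vandermondeℕ n (x ∘ suc)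

4*m≤n⇒3*n≤4*[n∸m] : ∀ {m n} → 4 * m ≤ n → 3 * n ≤ 4 * (n ∸ m)
4*m≤n⇒3*n≤4*[n∸m] {m} {n} 4m≤n = begin
  3 * n          ≡⟨ sym (m+n∸m≡n n (3 * n)) ⟩
  4 * n ∸ n      ≤⟨ ∸-monoʳ-≤ (4 * n) 4m≤n ⟩
  4 * n ∸ 4 * m  ≡⟨ sym (*-distribˡ-∸ 4 n m) ⟩
  4 * (n ∸ m)    ∎
  where open ≤-Reasoning

-- Each factor x j − x i of the Vandermonde product is at least (3/4) x j.
vandermondeℕ-lowerBound : ∀ n (x : Fin n → ℕ) → FourfoldIncreasing x →
  3 ^ triangle n * prodFin n (λ i → x i ^ toℕ i) ≤ 4 ^ triangle n * vandermondeℕ n x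
vandermondeℕ-lowerBound zero    x gaps = ≤-refl
vandermondeℕ-lowerBound (suc n) x gaps = begin
  3 ^ (n + triangle n) * (1 * prodFin n (λ j → x′ j ^ suc (toℕ j)))
    ≡⟨ cong₂ _*_ (^-distribˡ-+-* 3 n (triangle n)) (trans (*-identityˡ _) (prodFin-* n x′ _)) ⟩
  3 ^ n * 3 ^ triangle n * (prodFin n x′ * prodFin n (λ j → x′ j ^ toℕ j))
    ≡⟨ interchange (3 ^ n) _ _ _ ⟩
  3 ^ n * prodFin n x′ * (3 ^ triangle n * prodFin n (λ j → x′ j ^ toℕ j))
    ≤⟨ *-mono-≤ first-row (vandermondeℕ-lowerBound n x′ λ i j i<j → gaps (suc i) (suc j) (s≤s i<j)) ⟩
  4 ^ n * prodFin n (λ j → x′ j ∸ x zero) * (4 ^ triangle n * vandermondeℕ n x′)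
    ≡⟨ interchange (4 ^ n) _ _ _ ⟩
  4 ^ n * 4 ^ triangle n * vandermondeℕ (suc n) x
    ≡⟨ cong (_* vandermondeℕ (suc n) x) (sym (^-distribˡ-+-* 4 n (triangle n))) ⟩
  4 ^ (n + triangle n) * vandermondeℕ (suc n) x ∎
  where
  open ≤-Reasoning
  x′ : Fin n → ℕ
  x′ = x ∘ suc
  first-row : 3 ^ n * prodFin n x′ ≤ 4 ^ n * prodFin n (λ j → x′ j ∸ x zero)
  first-row = begin
    3 ^ n * prodFin n x′
      ≡⟨ sym (prodFin-*ˡ n 3 x′) ⟩
    prodFin n (λ j → 3 * x′ j)
      ≤⟨ prodFin-mono-≤ n (λ j → 4*m≤n⇒3*n≤4*[n∸m] {x zero} (gaps zero (suc j) (s≤s z≤n))) ⟩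
    prodFin n (λ j → 4 * (x′ j ∸ x zero))
      ≡⟨ prodFin-*ˡ n 4 _ ⟩
    4 ^ n * prodFin n (λ j → x′ j ∸ x zero) ∎

pos-^ : ∀ m n → + (m ^ n) ≡ (+ m) ℤ.^ n
pos-^ m zero    = refl
pos-^ m (suc n) = trans (ℤ.pos-* m (m ^ n)) (cong (+ m *ℤ_) (pos-^ m n))

prodFinℤ-pos : ∀ n (f : Fin n → ℕ) → prodFinℤ n (λ i → + f i) ≡ + prodFin n f
prodFinℤ-pos zero    f = refl
prodFinℤ-pos (suc n) f = trans (cong (+ f zero *ℤ_) (prodFinℤ-pos n (f ∘ suc))) (sym (ℤ.pos-* (f zero) _))

vandermonde-pos : ∀ n (x : Fin n → ℕ) → x Preserves Fin._≤_ ⟶ _≤_ →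
                  vandermonde n (λ i → + x i) ≡ + vandermondeℕ n x
vandermonde-pos zero    x x-mono = refl
vandermonde-pos (suc n) x x-mono =
  trans (cong₂ _*ℤ_ (trans (prodFinℤ-cong n difference) (prodFinℤ-pos n _))
                    (vandermonde-pos n (x ∘ suc) λ i≤j → x-mono (s≤s i≤j)))
        (sym (ℤ.pos-* (prodFin n (λ r → x (suc r) ∸ x zero)) (vandermondeℕ n (x ∘ suc))))
  where
  difference : ∀ r → + x (suc r) ℤ.- + x zero ≡ + (x (suc r) ∸ x zero)
  difference r = trans (ℤ.m-n≡m⊖n (x (suc r)) (x zero)) (ℤ.⊖-≥ (x-mono z≤n))

permuted-product-≤-vandermondeℕ : ∀ n (x : Fin n → ℕ) → FourfoldIncreasing x → (τ : Permutation′ n) →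
  3 ^ triangle n * prodFin n (λ i → x i ^ toℕ (τ ⟨$⟩ʳ i)) ≤ 4 ^ triangle n * vandermondeℕ n x
permuted-product-≤-vandermondeℕ n x gaps τ =
  ≤-trans (*-monoʳ-≤ (3 ^ triangle n) (prodFin-^-permute-≤ n x (fourfoldIncreasing⇒monotone gaps) τ))
          (vandermondeℕ-lowerBound n x gaps)

corollary4p3 : (n : ℕ) → 1 ≤ n → (ℓ : Fin n → ℕ) → (∀ i j → i < j → Data.Nat._<_ (ℓ i) (ℓ j)) →
    (τ : Permutation′ n) →
    let N = (n * (n ∸ 1)) / 2 in
    (+ (3 ^ N * prodFin n (λ i → 4 ^ (ℓ i * toℕ (τ ⟨$⟩ʳ i)))))
      ≤ℤ (+ (4 ^ N)) *ℤ det n (λ i j → + ((4 ^ ℓ i) ^ toℕ j))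
corollary4p3 n _ ℓ ℓ-increasing τ rewrite n*[n∸1]/2≡triangle n = begin
  + (3 ^ T * prodFin n (λ i → 4 ^ (ℓ i * toℕ (τ ⟨$⟩ʳ i))))
    ≡⟨ cong (λ p → + (3 ^ T * p)) (prodFin-cong n λ i → sym (^-*-assoc 4 (ℓ i) _)) ⟩
  + (3 ^ T * prodFin n (λ i → x i ^ toℕ (τ ⟨$⟩ʳ i)))
    ≤⟨ ℤ.+≤+ (permuted-product-≤-vandermondeℕ n x gaps τ) ⟩
  + (4 ^ T * vandermondeℕ n x)
    ≡⟨ ℤ.pos-* (4 ^ T) (vandermondeℕ n x) ⟩
  + (4 ^ T) *ℤ + vandermondeℕ n x
    ≡⟨ cong (+ (4 ^ T) *ℤ_) (sym det≡vandermondeℕ) ⟩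
  + (4 ^ T) *ℤ det n (λ i j → + ((4 ^ ℓ i) ^ toℕ j)) ∎
  where
  open ℤ.≤-Reasoning
  T : ℕ
  T = triangle n
  x : Fin n → ℕ
  x i = 4 ^ ℓ i
  gaps : FourfoldIncreasing x
  gaps i j i<j = ^-monoʳ-≤ 4 (ℓ-increasing i j i<j)
  det≡vandermondeℕ : det n (λ i j → + ((4 ^ ℓ i) ^ toℕ j)) ≡ + vandermondeℕ n x
  det≡vandermondeℕ = begin-equality
    det n (λ i j → + (x i ^ toℕ j))         ≡⟨ det-cong n (λ i j → pos-^ (x i) (toℕ j)) ⟩
    det n (λ i j → (+ x i) ℤ.^ toℕ j)       ≡⟨ det-vandermonde n (λ i → + x i) ⟩
    vandermonde n (λ i → + x i)             ≡⟨ vandermonde-pos n x (fourfoldIncreasing⇒monotone gaps) ⟩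
    + vandermondeℕ n x                      ∎
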